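{- Let $\mathbf v$ be a complementary symmetric Rote sequence and let $x$ be a non-empty prefix of $\mathbf v$. Denote $\mathbf u=\mathcal S(\mathbf v)=u_0u_1\cdots$ and $w=\mathcal S(x)$. An index $m$ is an occurrence of $x$ in $\mathbf v$ if and only if $m$ is an occurrence of $w$ in $\mathbf u$ and the prefix $u_0u_1\cdots u_{m-1}$ of $\mathbf u$ is stable.
   Context: A complementary symmetric Rote sequence is a sequence $\mathbf v\in\{0,1\}^{\mathbb N}$ with factor complexity $\mathcal C(n)=2n$ for all $n\ge1$ whose set of factors is closed under the exchange $0\leftrightarrow1$. For $v=v_0\cdots v_n\in\{0,1\}^+$, $\mathcal S(v)=u_0\cdots u_{n-1}$ with $u_i=v_i+v_{i+1}\bmod2$; for a sequence, $\mathcal S(\mathbf v)_i=v_i+v_{i+1}\bmod2$. A word $u\in\{0,1\}^*$ is stable if the number of letters $1$ in $u$ is even, and unstable otherwise. An occurrence of a word $y$ in a sequence is an index at which $y$ starts. -}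

module Defs where

open import Data.Bool using (Bool; true; false; not; _xor_)
open import Data.Nat using (ℕ; zero; suc; _+_; _*_)
open import Data.Nat.Properties using ()
open import Data.Fin using (Fin; toℕ)
open import Data.Vec using (Vec; []; _∷_; tabulate; map; count)
open import Data.List using (List; length)
open import Data.List.Membership.Propositional using (_∈_)
open import Data.List.Relation.Unary.Unique.Propositional using (Unique)
open import Data.Product using (Σ; ∃; _×_; _,_)
open import Relation.Binary.PropositionalEquality using (_≡_)
open import Relation.Unary using (Pred)
open import Data.Bool.Properties using (T?)
open import Function using (_∘_)

-- Infinite binary sequences (0 = false, 1 = true), indexed from 0.
Seq : Set
Seq = ℕ → Bool

window : Seq → ℕ → (n : ℕ) → Vec Bool n
window v i n = tabulate (λ k → v (i + toℕ k))

OccursAt : Seq → {n : ℕ} → Vec Bool n → ℕ → Set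
OccursAt v {n} y i = window v i n ≡ y

IsFactor : Seq → {n : ℕ} → Vec Bool n → Set
IsFactor v w = ∃ λ i → OccursAt v w i

ComplexityIs : Seq → ℕ → ℕ → Set
ComplexityIs v n k =
  Σ (List (Vec Bool n)) λ ws →
    Unique ws × length ws ≡ k × (∀ w → (w ∈ ws → IsFactor v w) × (IsFactor v w → w ∈ ws))

IsCSRote : Seq → Set
IsCSRote v =
  (∀ n → ComplexityIs v (suc n) (2 * suc n)) ×
  (∀ {n} (w : Vec Bool n) → IsFactor v w → IsFactor v (map not w))

Sw : {n : ℕ} → Vec Bool (suc n) → Vec Bool n
Sw (a ∷ []) = []
Sw (a ∷ b ∷ w) = (a xor b) ∷ Sw (b ∷ w)

Ss : Seq → Seq
Ss v i = v i xor v (suc i)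

ones : {n : ℕ} → Vec Bool n → ℕ
ones = count (T? ∘ (λ b → b))

data Even : ℕ → Set where
  even0 : Even 0
  even2 : ∀ {n} → Even n → Even (suc (suc n))

Stable : {n : ℕ} → Vec Bool n → Set
Stable w = Even (ones w)

-- A binary word is determined by its first letter and its image under S, so x
-- occurs at m exactly when S(x) occurs in S(v) at m and v_m = v_0. Summing
-- u_k = v_k + v_{k+1} over k < m telescopes to v_0 + v_m (mod 2), so v_m = v_0
-- exactly when u_0 ⋯ u_{m-1} is stable.
module Submission where

open import Defs
open import Data.Bool using (Bool; true; false; not; _xor_)
open import Data.Bool.Properties using (not-involutive; not-injective; xor-same; xor-assoc)
open import Data.Nat using (ℕ; zero; suc; _+_)
open import Data.Nat.Properties using (+-suc; +-identityʳ)
open import Data.Fin using (toℕ)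
open import Data.Product using (_×_; _,_; map₂)
open import Data.Vec using (Vec; []; _∷_; head; foldr′)
open import Data.Vec.Properties using (tabulate-cong; ∷-injective)
open import Function using (_∘_)
open import Function.Bundles using (_⇔_; mk⇔; Equivalence)
open import Relation.Binary.PropositionalEquality
  using (_≡_; refl; sym; trans; cong; cong₂; module ≡-Reasoning)

open Equivalence using (to; from)
open ≡-Reasoning

window-suc : ∀ v i n → window v i (suc n) ≡ v i ∷ window v (suc i) n
window-suc v i n =
  cong₂ _∷_ (cong v (+-identityʳ i)) (tabulate-cong (λ k → cong v (+-suc i (toℕ k))))

Sw-window : ∀ v i n → Sw (window v i (suc n)) ≡ window (Ss v) i n
Sw-window v i zero = refl
Sw-window v i (suc n) = begin
  Sw (window v i (suc (suc n)))               ≡⟨ cong Sw (window-suc v i (suc n)) ⟩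
  Sw (v i ∷ window v (suc i) (suc n))         ≡⟨ cong₂ _∷_ (cong (λ j → v i xor v j) (+-identityʳ (suc i)))
                                                           (Sw-window v (suc i) n) ⟩
  Ss v i ∷ window (Ss v) (suc i) n            ≡⟨ sym (window-suc (Ss v) i n) ⟩
  window (Ss v) i (suc n)                     ∎

xor-cancelˡ : ∀ x {y z} → x xor y ≡ x xor z → y ≡ z
xor-cancelˡ false y≡z = y≡z
xor-cancelˡ true ¬y≡¬z = not-injective ¬y≡¬z

xor≡false⇔≡ : ∀ x y → (x xor y ≡ false) ⇔ (x ≡ y)
xor≡false⇔≡ x y = mk⇔ (forward x y) (λ { refl → xor-same x })
  where
  forward : ∀ x y → x xor y ≡ false → x ≡ y
  forward false false _ = refl
  forward true  true  _ = refl

Sw-injective : ∀ {n} {x y : Vec Bool (suc n)} → head x ≡ head y → Sw x ≡ Sw y → x ≡ y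
Sw-injective {x = a ∷ []} {b ∷ []} a≡b _ = cong (_∷ []) a≡b
Sw-injective {x = a ∷ b ∷ x} {.a ∷ c ∷ y} refl Sx≡Sy with ∷-injective Sx≡Sy
... | a+b≡a+c , Sbx≡Scy = cong (a ∷_) (Sw-injective (xor-cancelˡ a a+b≡a+c) Sbx≡Scy)

parity : ℕ → Bool
parity zero    = false
parity (suc k) = not (parity k)

Even⇔parity≡false : ∀ k → Even k ⇔ (parity k ≡ false)
Even⇔parity≡false k = mk⇔ forward (backward k)
  where
  forward : ∀ {k} → Even k → parity k ≡ false
  forward even0     = refl
  forward (even2 e) = trans (not-involutive _) (forward e)

  backward : ∀ k → parity k ≡ false → Even k
  backward zero          _ = even0
  backward (suc (suc k)) p = even2 (backward k (trans (sym (not-involutive _)) p))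

parity-ones : ∀ {n} (w : Vec Bool n) → parity (ones w) ≡ foldr′ _xor_ false w
parity-ones []          = refl
parity-ones (true ∷ w)  = cong not (parity-ones w)
parity-ones (false ∷ w) = parity-ones w

xor-window-Ss : ∀ v i m → foldr′ _xor_ false (window (Ss v) i m) ≡ v i xor v (i + m)
xor-window-Ss v i zero = sym (trans (cong (λ j → v i xor v j) (+-identityʳ i)) (xor-same (v i)))
xor-window-Ss v i (suc m) = begin
  foldr′ _xor_ false (window (Ss v) i (suc m))        ≡⟨ cong (foldr′ _xor_ false) (window-suc (Ss v) i m) ⟩
  (v i xor v i′) xor foldr′ _xor_ false (window (Ss v) i′ m)
                                                      ≡⟨ cong ((v i xor v i′) xor_) (xor-window-Ss v i′ m) ⟩
  (v i xor v i′) xor (v i′ xor v (i′ + m))            ≡⟨ xor-assoc (v i) (v i′) _ ⟩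
  v i xor (v i′ xor (v i′ xor v (i′ + m)))            ≡⟨ cong (v i xor_) (sym (xor-assoc (v i′) (v i′) _)) ⟩
  v i xor ((v i′ xor v i′) xor v (i′ + m))            ≡⟨ cong (λ b → v i xor (b xor v (i′ + m))) (xor-same (v i′)) ⟩
  v i xor v (i′ + m)                                  ≡⟨ cong (λ j → v i xor v j) (sym (+-suc i m)) ⟩
  v i xor v (i + suc m)                               ∎
  where i′ = suc i

stable-window-Ss : ∀ v i m → Stable (window (Ss v) i m) ⇔ (v i ≡ v (i + m))
stable-window-Ss v i m = mk⇔
  (to (xor≡false⇔≡ _ _) ∘ trans (sym parity≡) ∘ to (Even⇔parity≡false _))
  (from (Even⇔parity≡false _) ∘ trans parity≡ ∘ from (xor≡false⇔≡ _ _))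
  where
  parity≡ : parity (ones (window (Ss v) i m)) ≡ v i xor v (i + m)
  parity≡ = trans (parity-ones (window (Ss v) i m)) (xor-window-Ss v i m)

occursAt⇔occursAt-Ss : ∀ v {n} (x : Vec Bool (suc n)) m →
  OccursAt v x m ⇔ (OccursAt (Ss v) (Sw x) m × v m ≡ head x)
occursAt⇔occursAt-Ss v {n} x m = mk⇔
  (λ occ → trans (sym (Sw-window v m n)) (cong Sw occ)
         , trans (cong v (sym (+-identityʳ m))) (cong head occ))
  (λ (Socc , vm≡x₀) → Sw-injective (trans (cong v (+-identityʳ m)) vm≡x₀)
                                   (trans (Sw-window v m n) Socc))

lemma3p7 : (v : Seq) → IsCSRote v → (n : ℕ) → (m : ℕ)
    → OccursAt v (window v 0 (suc n)) m
    ⇔ (OccursAt (Ss v) (Sw (window v 0 (suc n))) m × Stable (window (Ss v) 0 m))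
lemma3p7 v _ n m = mk⇔
  (map₂ (from stable ∘ sym) ∘ to occurs)
  (from occurs ∘ map₂ (sym ∘ to stable))
  where
  occurs : OccursAt v (window v 0 (suc n)) m
         ⇔ (OccursAt (Ss v) (Sw (window v 0 (suc n))) m × v m ≡ v 0)
  occurs = occursAt⇔occursAt-Ss v (window v 0 (suc n)) m

  stable : Stable (window (Ss v) 0 m) ⇔ (v 0 ≡ v m)
  stable = stable-window-Ss v 0 m
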